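{- For any $s\in S^c$, any $i\in\mathbf{Ag}$ and any formula $\phi$: if $\neg\Box_i\phi\in\Gamma_s$, then there is $t\in S^c$ with $sR^c_it$ and $\neg\phi\in\Gamma_t$.
   Context: Language $\mathcal{L}$: fix countably infinite sets $\mathbf{P}$ (proposition letters), $\mathbf{Ag}$ (agents), $\mathbf{D}$ (constant symbols); formulas $\phi ::= \top\mid p\mid\neg\phi\mid(\phi\wedge\phi)\mid\Box_i\phi\mid\nabla_i(\phi,d)$, with $\Diamond_i\phi:=\neg\Box_i\neg\phi$ and usual Boolean abbreviations. Proof system $\mathbf{SLKvr}$: axioms all tautologies; $\Box_i(\phi\to\psi)\to(\Box_i\phi\to\Box_i\psi)$; $\Box_i(\phi\to\psi)\to(\nabla_i(\psi,d)\to\nabla_i(\phi,d))$; $\nabla_i(\bot,d)$; $\Diamond_i(\phi\wedge\psi)\wedge\nabla_i(\phi,d)\wedge\nabla_i(\psi,d)\to\nabla_i(\phi\vee\psi,d)$; rules modus ponens, necessitation for $\Box_i$, and replacement of provable equivalents. Canonical structure: $S^c$ is the set of all triples $\langle\Gamma,f,g\rangle$ where $\Gamma$ is a maximal $\mathbf{SLKvr}$-consistent set, $f:\mathbf{D}\to\mathbb{N}$, $g:\mathbf{Ag}\times\mathcal{L}\times\mathbf{D}\to\mathbb{N}\cup\{*\}$ (with $*\notin\mathbb{N}$), such that for all $i,\phi,\psi,d$: (1) $g(i,\phi,d)\neq *$ iff $\nabla_i(\phi,d)\wedge\Diamond_i\phi\in\Gamma$; (2) if $g(i,\phi,d)\neq*$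 and $g(i,\psi,d)\neq*$ then: $g(i,\phi,d)=g(i,\psi,d)$ iff $\nabla_i(\phi\vee\psi,d)\in\Gamma$. For $s\in S^c$ write $s=\langle\Gamma_s,f_s,g_s\rangle$. For $s,t\in S^c$, $sR^c_it$ iff (3) $\{\phi\mid\Box_i\phi\in\Gamma_s\}\subseteq\Gamma_t$ and (4) whenever $\nabla_i(\phi,d)\in\Gamma_s$ and $\phi\in\Gamma_t$, $f_t(d)=g_s(i,\phi,d)$. -}

module Defs where

open import Level using (0ℓ)
open import Data.Nat using (ℕ)
open import Data.Bool using (Bool; true; false; not; _∧_)
open import Data.Maybe using (Maybe; just; nothing)
open import Data.List using (List; []; _∷_)
open import Data.List.Relation.Unary.All using (All)
open import Data.Product using (Σ; _×_)
open import Relation.Binary.PropositionalEquality using (_≡_; _≢_)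
open import Relation.Nullary using (¬_)

-- P, Ag, D : countably infinite sets, represented by ℕ
Prop' Agent Const : Set
Prop' = ℕ
Agent = ℕ
Const = ℕ

data Fm : Set where
  ⊤'  : Fm
  var : Prop' → Fm
  ¬'_ : Fm → Fm
  _∧'_ : Fm → Fm → Fm
  □   : Agent → Fm → Fm
  ∇   : Agent → Fm → Const → Fm

infix  30 ¬'_
infixr 20 _∧'_
infixr 19 _∨'_
infixr 18 _⇒'_
infix  17 _⇔'_

⊥' : Fm
⊥' = ¬' ⊤'

_∨'_ : Fm → Fm → Fm
φ ∨' ψ = ¬' (¬' φ ∧' ¬' ψ)

_⇒'_ : Fm → Fm → Fm
φ ⇒' ψ = ¬' (φ ∧' ¬' ψ)

_⇔'_ : Fm → Fm → Fm
φ ⇔' ψ = (φ ⇒' ψ) ∧' (ψ ⇒' φ)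

◇ : Agent → Fm → Fm
◇ i φ = ¬' □ i (¬' φ)

eval : (Fm → Bool) → Fm → Bool
eval v ⊤' = true
eval v (var p) = v (var p)
eval v (¬' φ) = not (eval v φ)
eval v (φ ∧' ψ) = eval v φ ∧ eval v ψ
eval v (□ i φ) = v (□ i φ)
eval v (∇ i φ d) = v (∇ i φ d)

Tautology : Fm → Set
Tautology φ = (v : Fm → Bool) → eval v φ ≡ true

data Ctx : Set where
  hole : Ctx
  ¬c   : Ctx → Ctx
  ∧l   : Ctx → Fm → Ctx
  ∧r   : Fm → Ctx → Ctx
  □c   : Agent → Ctx → Ctx
  ∇c   : Agent → Ctx → Const → Ctx

plug : Ctx → Fm → Fm
plug hole φ = φ
plug (¬c C) φ = ¬' plug C φ
plug (∧l C ψ) φ = plug C φ ∧' ψ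
plug (∧r ψ C) φ = ψ ∧' plug C φ
plug (□c i C) φ = □ i (plug C φ)
plug (∇c i C d) φ = ∇ i (plug C φ) d

data ⊢_ : Fm → Set where
  taut  : ∀ {φ} → Tautology φ → ⊢ φ
  K     : ∀ i φ ψ → ⊢ (□ i (φ ⇒' ψ) ⇒' (□ i φ ⇒' □ i ψ))
  ∇mono : ∀ i φ ψ d → ⊢ (□ i (φ ⇒' ψ) ⇒' (∇ i ψ d ⇒' ∇ i φ d))
  ∇bot  : ∀ i d → ⊢ ∇ i ⊥' d
  ∇join : ∀ i φ ψ d →
          ⊢ ((◇ i (φ ∧' ψ) ∧' ∇ i φ d ∧' ∇ i ψ d) ⇒' ∇ i (φ ∨' ψ) d)
  mp    : ∀ {φ ψ} → ⊢ (φ ⇒' ψ) → ⊢ φ → ⊢ ψ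
  nec   : ∀ {φ} i → ⊢ φ → ⊢ □ i φ
  repl  : ∀ {φ ψ} (C : Ctx) → ⊢ (φ ⇔' ψ) → ⊢ plug C φ → ⊢ plug C ψ

infix 10 ⊢_

FmSet : Set₁
FmSet = Fm → Set

conj : List Fm → Fm
conj [] = ⊤'
conj (φ ∷ l) = φ ∧' conj l

Consistent : FmSet → Set
Consistent Γ = ¬ (Σ (List Fm) λ l → All Γ l × (⊢ ¬' conj l))

_⊆_ : FmSet → FmSet → Set
Γ ⊆ Δ = ∀ φ → Γ φ → Δ φ

MaxCons : FmSet → Set₁
MaxCons Γ = Consistent Γ × ((Δ : FmSet) → Γ ⊆ Δ → Consistent Δ → Δ ⊆ Γ)

-- Canonical structure. nothing plays the role of *.
record State : Set₁ where
  field
    Γ   : FmSet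
    mcs : MaxCons Γ
    f   : Const → ℕ
    g   : Agent → Fm → Const → Maybe ℕ
    c1  : ∀ i φ d → (g i φ d ≢ nothing → Γ (∇ i φ d ∧' ◇ i φ))
                  × (Γ (∇ i φ d ∧' ◇ i φ) → g i φ d ≢ nothing)
    c2  : ∀ i φ ψ d (n m : ℕ) → g i φ d ≡ just n → g i ψ d ≡ just m →
          (n ≡ m → Γ (∇ i (φ ∨' ψ) d)) × (Γ (∇ i (φ ∨' ψ) d) → n ≡ m)

open State public

Rc : Agent → State → State → Set
Rc i s t = (∀ φ → Γ s (□ i φ) → Γ t φ)
         × (∀ φ d → Γ s (∇ i φ d) → Γ t φ → g s i φ d ≡ just (f t d))

-- The set {ψ | □ᵢψ ∈ Γₛ} ∪ {¬φ} is consistent, since □ᵢ distributes over finite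
-- conjunctions; extend it to a maximal consistent Δ by Lindenbaum's construction, which
-- enumerates formulas through an injective coding into ℕ. Every ψ ∈ Δ has ◇ᵢψ ∈ Γₛ, so
-- whenever ∇ᵢ(ψ,d), ∇ᵢ(χ,d) ∈ Γₛ with ψ, χ ∈ Δ, the ∇join axiom puts ∇ᵢ(ψ∨χ,d) in Γₛ and
-- condition (2) gives gₛ(i,ψ,d) = gₛ(i,χ,d); this common value is f_t(d) (any value
-- when there is no such ψ), which is exactly condition (4). Finally every maximal
-- consistent set carries a g satisfying (1) and (2): by ∇join, ∇ⱼ(ψ∨χ,d) is an
-- equivalence on the ψ with ∇ⱼ(ψ,d) ∧ ◇ⱼψ, and g assigns each class the least code of a
-- member. Excluded middle makes Lindenbaum's choices, the least codes and f_t.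

module Submission where

open import Defs
open import Level using (0ℓ)
open import Axiom.ExcludedMiddle using (ExcludedMiddle)
open import Data.Bool using (Bool; true; false)
open import Data.Bool.Properties using (_≟_)
open import Data.Nat using (ℕ; zero; suc; _<_; _⊔_; _≤′_; ≤′-reflexive; ≤′-step)
open import Data.Nat.Properties using (<-cmp; ≤⇒≤′; m≤m⊔n; m≤n⊔m)
open import Data.Nat.Induction using (<-rec)
open import Data.Nat.Binary using (ℕᵇ; 2[1+_]; 1+[2_]) renaming (zero to 0ᵇ; toℕ to toℕᵇ)
open import Data.Nat.Binary.Properties using (toℕ-injective)
open import Data.Maybe using (Maybe; just; nothing)
open import Data.List using (List; []; _∷_; _++_)
open import Data.List.Relation.Unary.All as All using (All; []; _∷_)
open import Data.List.Relation.Unary.All.Properties using (++⁺)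
open import Data.Product using (Σ; ∃; _×_; _,_; proj₁; proj₂)
open import Data.Sum using (_⊎_; inj₁; inj₂; [_,_]; reduce)
open import Data.Empty using (⊥-elim)
open import Function using (const)
open import Relation.Nullary using (¬_; Dec; yes; no)
open import Relation.Binary.PropositionalEquality using (_≡_; _≢_; refl; sym; trans; cong)
open import Relation.Binary.Definitions using (tri<; tri≈; tri>)

Holds : (Fm → Bool) → Fm → Set
Holds v φ = eval v φ ≡ true

holds? : ∀ v φ → Dec (Holds v φ)
holds? v φ = eval v φ ≟ true

holds-stable : ∀ v φ → ¬ ¬ Holds v φ → Holds v φ
holds-stable v φ ¬¬h with holds? v φ
... | yes h = h
... | no ¬h = ⊥-elim (¬¬h ¬h)

holds-¬⁺ : ∀ v φ → ¬ Holds v φ → Holds v (¬' φ)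
holds-¬⁺ v φ ¬h with eval v φ
... | true  = ⊥-elim (¬h refl)
... | false = refl

holds-¬⁻ : ∀ v φ → Holds v (¬' φ) → ¬ Holds v φ
holds-¬⁻ v φ h with eval v φ
holds-¬⁻ v φ () | true
... | false = λ ()

holds-∧⁺ : ∀ v φ ψ → Holds v φ → Holds v ψ → Holds v (φ ∧' ψ)
holds-∧⁺ v φ ψ hφ hψ rewrite hφ | hψ = refl

holds-∧⁻ : ∀ v φ ψ → Holds v (φ ∧' ψ) → Holds v φ × Holds v ψ
holds-∧⁻ v φ ψ h with eval v φ | eval v ψ
... | true | true = refl , refl
holds-∧⁻ v φ ψ () | true  | false
holds-∧⁻ v φ ψ () | false | _

holds-⇒⁺ : ∀ v φ ψ → (Holds v φ → Holds v ψ) → Holds v (φ ⇒' ψ)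
holds-⇒⁺ v φ ψ h = holds-¬⁺ v (φ ∧' ¬' ψ) λ h' →
  let hφ , h¬ψ = holds-∧⁻ v φ (¬' ψ) h' in holds-¬⁻ v ψ h¬ψ (h hφ)

holds-⇒⁻ : ∀ v φ ψ → Holds v (φ ⇒' ψ) → Holds v φ → Holds v ψ
holds-⇒⁻ v φ ψ h hφ = holds-stable v ψ λ ¬hψ →
  holds-¬⁻ v (φ ∧' ¬' ψ) h (holds-∧⁺ v φ (¬' ψ) hφ (holds-¬⁺ v ψ ¬hψ))

holds-∨⁺ˡ : ∀ v φ ψ → Holds v φ → Holds v (φ ∨' ψ)
holds-∨⁺ˡ v φ ψ hφ = holds-¬⁺ v (¬' φ ∧' ¬' ψ) λ h →
  holds-¬⁻ v φ (proj₁ (holds-∧⁻ v (¬' φ) (¬' ψ) h)) hφ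

holds-∨⁺ʳ : ∀ v φ ψ → Holds v ψ → Holds v (φ ∨' ψ)
holds-∨⁺ʳ v φ ψ hψ = holds-¬⁺ v (¬' φ ∧' ¬' ψ) λ h →
  holds-¬⁻ v ψ (proj₂ (holds-∧⁻ v (¬' φ) (¬' ψ) h)) hψ

holds-∨⁻ : ∀ v φ ψ → Holds v (φ ∨' ψ) → Holds v φ ⊎ Holds v ψ
holds-∨⁻ v φ ψ h with holds? v φ
... | yes hφ = inj₁ hφ
... | no ¬hφ = inj₂ (holds-stable v ψ λ ¬hψ →
  holds-¬⁻ v (¬' φ ∧' ¬' ψ) h (holds-∧⁺ v (¬' φ) (¬' ψ) (holds-¬⁺ v φ ¬hφ) (holds-¬⁺ v ψ ¬hψ)))

holds-conj-++⁻ : ∀ v l m → Holds v (conj (l ++ m)) → Holds v (conj l) × Holds v (conj m)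
holds-conj-++⁻ v []      m h = refl , h
holds-conj-++⁻ v (φ ∷ l) m h =
  let hφ , hl++m = holds-∧⁻ v φ (conj (l ++ m)) h
      hl , hm = holds-conj-++⁻ v l m hl++m
  in holds-∧⁺ v φ (conj l) hφ hl , hm

infix 4 _⊨_

_⊨_ : Fm → Fm → Set
φ ⊨ ψ = ∀ v → Holds v φ → Holds v ψ

tautology : ∀ {φ ψ} → φ ⊨ ψ → ⊢ φ ⇒' ψ
tautology {φ} {ψ} φ⊨ψ = taut λ v → holds-⇒⁺ v φ ψ (φ⊨ψ v)

mp-⊨ : ∀ {φ ψ} → ⊢ φ → φ ⊨ ψ → ⊢ ψ
mp-⊨ ⊢φ φ⊨ψ = mp (tautology φ⊨ψ) ⊢φ

⊢-∧ : ∀ {φ ψ} → ⊢ φ → ⊢ ψ → ⊢ φ ∧' ψ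
⊢-∧ {φ} {ψ} ⊢φ ⊢ψ = mp (mp-⊨ ⊢φ λ v hφ → holds-⇒⁺ v ψ (φ ∧' ψ) (holds-∧⁺ v φ ψ hφ)) ⊢ψ

⇒¬¬⊨⇒ : ∀ {φ ψ} → φ ⇒' ¬' ¬' ψ ⊨ φ ⇒' ψ
⇒¬¬⊨⇒ {φ} {ψ} v h = holds-⇒⁺ v φ ψ λ hφ → holds-stable v ψ λ ¬hψ →
  holds-¬⁻ v (¬' ψ) (holds-⇒⁻ v φ (¬' ¬' ψ) h hφ) (holds-¬⁺ v ψ ¬hψ)

infixl 25 _⊕_

_⊕_ : FmSet → Fm → FmSet
(S ⊕ ψ) φ = S φ ⊎ φ ≡ ψ

split-⊕ : ∀ {S ψ} l → All (S ⊕ ψ) l → Σ (List Fm) λ m → All S m × (conj m ∧' ψ ⊨ conj l)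
split-⊕ [] [] = [] , [] , λ _ _ → refl
split-⊕ {ψ = ψ} (φ ∷ l) (_ ∷ l⊆) with split-⊕ l l⊆
split-⊕ {ψ = ψ} (φ ∷ l) (inj₁ φ∈S ∷ l⊆) | m , m⊆ , sound =
  φ ∷ m , φ∈S ∷ m⊆ , λ v h →
    let hφm , hψ = holds-∧⁻ v (φ ∧' conj m) ψ h
        hφ , hm = holds-∧⁻ v φ (conj m) hφm
    in holds-∧⁺ v φ (conj l) hφ (sound v (holds-∧⁺ v (conj m) ψ hm hψ))
split-⊕ {ψ = ψ} (ψ ∷ l) (inj₂ refl ∷ l⊆) | m , m⊆ , sound =
  m , m⊆ , λ v h → holds-∧⁺ v ψ (conj l) (proj₂ (holds-∧⁻ v (conj m) ψ h)) (sound v h)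

⊕-consistent : ∀ {S ψ} → (∀ l → All S l → ¬ (⊢ conj l ⇒' ¬' ψ)) → Consistent (S ⊕ ψ)
⊕-consistent {ψ = ψ} refute (l , l⊆ , ⊢¬l) with split-⊕ l l⊆
... | m , m⊆ , sound = refute m m⊆ (mp-⊨ ⊢¬l λ v h¬l → holds-⇒⁺ v (conj m) (¬' ψ) λ hm →
  holds-¬⁺ v ψ λ hψ → holds-¬⁻ v (conj l) h¬l (sound v (holds-∧⁺ v (conj m) ψ hm hψ)))

module MCS {Γ : FmSet} (mc : MaxCons Γ) where

  private
    consistent = proj₁ mc
    maximal = proj₂ mc

    extend-by : ∀ φ → Consistent (Γ ⊕ φ) → Γ φ
    extend-by φ cons = maximal (Γ ⊕ φ) (λ _ → inj₁) cons φ (inj₂ refl)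

  derivable-∈ : ∀ {l φ} → All Γ l → ⊢ conj l ⇒' φ → Γ φ
  derivable-∈ {l} {φ} l⊆ ⊢l⇒φ = extend-by φ (⊕-consistent λ m m⊆ ⊢m⇒¬φ →
    consistent (l ++ m , ++⁺ l⊆ m⊆ , mp-⊨ (⊢-∧ ⊢l⇒φ ⊢m⇒¬φ) λ v h →
      let hl⇒φ , hm⇒¬φ = holds-∧⁻ v (conj l ⇒' φ) (conj m ⇒' ¬' φ) h
      in holds-¬⁺ v (conj (l ++ m)) λ hlm →
        let hl , hm = holds-conj-++⁻ v l m hlm
        in holds-¬⁻ v φ (holds-⇒⁻ v (conj m) (¬' φ) hm⇒¬φ hm) (holds-⇒⁻ v (conj l) φ hl⇒φ hl)))

  theorem-∈ : ∀ {φ} → ⊢ φ → Γ φ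
  theorem-∈ {φ} ⊢φ = derivable-∈ [] (mp-⊨ ⊢φ λ v hφ → holds-⇒⁺ v ⊤' φ (const hφ))

  ⇒-∈ : ∀ {φ ψ} → Γ (φ ⇒' ψ) → Γ φ → Γ ψ
  ⇒-∈ {φ} {ψ} φ⇒ψ∈ φ∈ = derivable-∈ (φ⇒ψ∈ ∷ φ∈ ∷ []) (tautology λ v h →
    let hφ⇒ψ , hφ⊤ = holds-∧⁻ v (φ ⇒' ψ) (φ ∧' ⊤') h
    in holds-⇒⁻ v φ ψ hφ⇒ψ (proj₁ (holds-∧⁻ v φ ⊤' hφ⊤)))

  ⊨-∈ : ∀ {φ ψ} → Γ φ → φ ⊨ ψ → Γ ψ
  ⊨-∈ φ∈ φ⊨ψ = ⇒-∈ (theorem-∈ (tautology φ⊨ψ)) φ∈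

  ∧-∈ : ∀ {φ ψ} → Γ φ → Γ ψ → Γ (φ ∧' ψ)
  ∧-∈ {φ} {ψ} φ∈ ψ∈ =
    ⇒-∈ (⊨-∈ φ∈ λ v hφ → holds-⇒⁺ v ψ (φ ∧' ψ) (holds-∧⁺ v φ ψ hφ)) ψ∈

  ∧-∈ˡ : ∀ {φ ψ} → Γ (φ ∧' ψ) → Γ φ
  ∧-∈ˡ {φ} {ψ} φ∧ψ∈ = ⊨-∈ φ∧ψ∈ λ v h → proj₁ (holds-∧⁻ v φ ψ h)

  ∧-∈ʳ : ∀ {φ ψ} → Γ (φ ∧' ψ) → Γ ψ
  ∧-∈ʳ {φ} {ψ} φ∧ψ∈ = ⊨-∈ φ∧ψ∈ λ v h → proj₂ (holds-∧⁻ v φ ψ h)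

  ¬-∈⇒∉ : ∀ {φ} → Γ (¬' φ) → ¬ Γ φ
  ¬-∈⇒∉ {φ} ¬φ∈ φ∈ = consistent (φ ∷ ¬' φ ∷ [] , φ∈ ∷ ¬φ∈ ∷ [] , taut λ v →
    holds-¬⁺ v (φ ∧' ¬' φ ∧' ⊤') λ h →
      let hφ , h¬φ⊤ = holds-∧⁻ v φ (¬' φ ∧' ⊤') h
      in holds-¬⁻ v φ (proj₁ (holds-∧⁻ v (¬' φ) ⊤' h¬φ⊤)) hφ)

  ∉⇒¬-∈ : ∀ {φ} → ¬ Γ φ → Γ (¬' φ)
  ∉⇒¬-∈ {φ} φ∉ = extend-by (¬' φ) (⊕-consistent λ m m⊆ ⊢m⇒¬¬φ →
    φ∉ (derivable-∈ m⊆ (mp-⊨ ⊢m⇒¬¬φ (⇒¬¬⊨⇒ {conj m} {φ}))))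

  ∈-stable : ∀ {φ} → ¬ ¬ Γ φ → Γ φ
  ∈-stable {φ} ¬¬φ∈ = extend-by φ (⊕-consistent λ m m⊆ ⊢m⇒¬φ →
    ¬¬φ∈ (¬-∈⇒∉ (derivable-∈ m⊆ ⊢m⇒¬φ)))

  □-mono-∈ : ∀ {i φ ψ} → ⊢ φ ⇒' ψ → Γ (□ i φ) → Γ (□ i ψ)
  □-mono-∈ {i} {φ} {ψ} ⊢φ⇒ψ = ⇒-∈ (⇒-∈ (theorem-∈ (K i φ ψ)) (theorem-∈ (nec i ⊢φ⇒ψ)))

  □-∧-∈ : ∀ {i φ ψ} → Γ (□ i φ) → Γ (□ i ψ) → Γ (□ i (φ ∧' ψ))
  □-∧-∈ {i} {φ} {ψ} □φ∈ = ⇒-∈ (⇒-∈ (theorem-∈ (K i ψ (φ ∧' ψ)))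
    (□-mono-∈ (tautology λ v hφ → holds-⇒⁺ v ψ (φ ∧' ψ) (holds-∧⁺ v φ ψ hφ)) □φ∈))

  □-conj-∈ : ∀ {i l} → All (λ φ → Γ (□ i φ)) l → Γ (□ i (conj l))
  □-conj-∈ {i} []           = theorem-∈ (nec i (taut λ _ → refl))
  □-conj-∈     (□φ∈ ∷ □l∈) = □-∧-∈ □φ∈ (□-conj-∈ □l∈)

  ◇-mono-∈ : ∀ {i φ ψ} → ⊢ φ ⇒' ψ → Γ (◇ i φ) → Γ (◇ i ψ)
  ◇-mono-∈ {φ = φ} {ψ} ⊢φ⇒ψ ◇φ∈ = ∉⇒¬-∈ λ □¬ψ∈ → ¬-∈⇒∉ ◇φ∈ (□-mono-∈ (mp-⊨ ⊢φ⇒ψ λ v h →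
    holds-⇒⁺ v (¬' ψ) (¬' φ) λ h¬ψ → holds-¬⁺ v φ λ hφ → holds-¬⁻ v ψ h¬ψ (holds-⇒⁻ v φ ψ h hφ)) □¬ψ∈)

  ∇-antitone-∈ : ∀ {i φ ψ d} → ⊢ φ ⇒' ψ → Γ (∇ i ψ d) → Γ (∇ i φ d)
  ∇-antitone-∈ {i} {φ} {ψ} {d} ⊢φ⇒ψ = ⇒-∈ (⇒-∈ (theorem-∈ (∇mono i φ ψ d)) (theorem-∈ (nec i ⊢φ⇒ψ)))

  ∇-join-∈ : ∀ {i φ ψ d} → Γ (◇ i (φ ∧' ψ)) → Γ (∇ i φ d) → Γ (∇ i ψ d) → Γ (∇ i (φ ∨' ψ) d)
  ∇-join-∈ {i} {φ} {ψ} {d} ◇∈ ∇φ∈ ∇ψ∈ = ⇒-∈ (theorem-∈ (∇join i φ ψ d)) (∧-∈ ◇∈ (∧-∈ ∇φ∈ ∇ψ∈))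

  ∇∨-refl : ∀ {i φ d} → Γ (∇ i φ d) → Γ (∇ i (φ ∨' φ) d)
  ∇∨-refl {φ = φ} = ∇-antitone-∈ (tautology λ v h → reduce (holds-∨⁻ v φ φ h))

  ∇∨-sym : ∀ {i φ ψ d} → Γ (∇ i (φ ∨' ψ) d) → Γ (∇ i (ψ ∨' φ) d)
  ∇∨-sym {φ = φ} {ψ} = ∇-antitone-∈ (tautology λ v h →
    [ holds-∨⁺ʳ v φ ψ , holds-∨⁺ˡ v φ ψ ] (holds-∨⁻ v ψ φ h))

  ∇∨-trans : ∀ {i φ ψ χ d} → Γ (◇ i ψ) →
             Γ (∇ i (φ ∨' ψ) d) → Γ (∇ i (ψ ∨' χ) d) → Γ (∇ i (φ ∨' χ) d)
  ∇∨-trans {i} {φ} {ψ} {χ} ◇ψ∈ φψ∈ ψχ∈ = ∇-antitone-∈ φχ⇒join (∇-join-∈ ◇join∈ φψ∈ ψχ∈)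
    where
    φχ⇒join : ⊢ (φ ∨' χ) ⇒' ((φ ∨' ψ) ∨' (ψ ∨' χ))
    φχ⇒join = tautology λ v h → [ (λ hφ → holds-∨⁺ˡ v (φ ∨' ψ) (ψ ∨' χ) (holds-∨⁺ˡ v φ ψ hφ))
                                , (λ hχ → holds-∨⁺ʳ v (φ ∨' ψ) (ψ ∨' χ) (holds-∨⁺ʳ v ψ χ hχ)) ]
                                (holds-∨⁻ v φ χ h)
    ◇join∈ : Γ (◇ i ((φ ∨' ψ) ∧' (ψ ∨' χ)))
    ◇join∈ = ◇-mono-∈ (tautology λ v hψ → holds-∧⁺ v (φ ∨' ψ) (ψ ∨' χ)
                         (holds-∨⁺ʳ v φ ψ hψ) (holds-∨⁺ˡ v ψ χ hψ)) ◇ψ∈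

unary : ℕ → ℕᵇ → ℕᵇ
unary zero    r = 1+[2 r ]
unary (suc n) r = 2[1+ unary n r ]

unary-injective : ∀ m n {r r′} → unary m r ≡ unary n r′ → m ≡ n × r ≡ r′
unary-injective zero    zero    refl = refl , refl
unary-injective (suc m) (suc n) e    with unary-injective m n (2[1+]-injective e)
  where
  2[1+]-injective : ∀ {x y} → 2[1+ x ] ≡ 2[1+ y ] → x ≡ y
  2[1+]-injective refl = refl
... | refl , refl = refl , refl

-- A prefix code: each constructor writes a unary tag, then its fields in order, onto the rest r.
encode : Fm → ℕᵇ → ℕᵇ
encode ⊤'        r = unary 0 r
encode (var p)   r = unary 1 (unary p r)
encode (¬' φ)    r = unary 2 (encode φ r)
encode (φ ∧' ψ)  r = unary 3 (encode φ (encode ψ r))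
encode (□ i φ)   r = unary 4 (unary i (encode φ r))
encode (∇ i φ d) r = unary 5 (unary i (encode φ (unary d r)))

encode-injective : ∀ φ ψ {r r′} → encode φ r ≡ encode ψ r′ → φ ≡ ψ × r ≡ r′
encode-injective ⊤'        ⊤'           refl = refl , refl
encode-injective (var p)   (var q)      e with unary-injective p q (proj₂ (unary-injective 1 1 e))
... | refl , refl = refl , refl
encode-injective (¬' φ)    (¬' ψ)       e with encode-injective φ ψ (proj₂ (unary-injective 2 2 e))
... | refl , refl = refl , refl
encode-injective (φ ∧' ψ)  (φ′ ∧' ψ′)   e with encode-injective φ φ′ (proj₂ (unary-injective 3 3 e))
... | refl , e′ with encode-injective ψ ψ′ e′
... | refl , refl = refl , refl
encode-injective (□ i φ)   (□ j ψ)      e with unary-injective i j (proj₂ (unary-injective 4 4 e))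
... | refl , e′ with encode-injective φ ψ e′
... | refl , refl = refl , refl
encode-injective (∇ i φ d) (∇ j ψ d′)   e with unary-injective i j (proj₂ (unary-injective 5 5 e))
... | refl , e′ with encode-injective φ ψ e′
... | refl , e″ with unary-injective d d′ e″
... | refl , refl = refl , refl
encode-injective ⊤'        (var _)      ()
encode-injective ⊤'        (¬' _)       ()
encode-injective ⊤'        (_ ∧' _)     ()
encode-injective ⊤'        (□ _ _)      ()
encode-injective ⊤'        (∇ _ _ _)    ()
encode-injective (var _)   ⊤'           ()
encode-injective (var _)   (¬' _)       ()
encode-injective (var _)   (_ ∧' _)     ()
encode-injective (var _)   (□ _ _)      ()
encode-injective (var _)   (∇ _ _ _)    ()
encode-injective (¬' _)    ⊤'           ()
encode-injective (¬' _)    (var _)      ()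
encode-injective (¬' _)    (_ ∧' _)     ()
encode-injective (¬' _)    (□ _ _)      ()
encode-injective (¬' _)    (∇ _ _ _)    ()
encode-injective (_ ∧' _)  ⊤'           ()
encode-injective (_ ∧' _)  (var _)      ()
encode-injective (_ ∧' _)  (¬' _)       ()
encode-injective (_ ∧' _)  (□ _ _)      ()
encode-injective (_ ∧' _)  (∇ _ _ _)    ()
encode-injective (□ _ _)   ⊤'           ()
encode-injective (□ _ _)   (var _)      ()
encode-injective (□ _ _)   (¬' _)       ()
encode-injective (□ _ _)   (_ ∧' _)     ()
encode-injective (□ _ _)   (∇ _ _ _)    ()
encode-injective (∇ _ _ _) ⊤'           ()
encode-injective (∇ _ _ _) (var _)      ()
encode-injective (∇ _ _ _) (¬' _)       ()
encode-injective (∇ _ _ _) (_ ∧' _)     ()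
encode-injective (∇ _ _ _) (□ _ _)      ()

code : Fm → ℕ
code φ = toℕᵇ (encode φ 0ᵇ)

code-injective : ∀ {φ ψ} → code φ ≡ code ψ → φ ≡ ψ
code-injective {φ} {ψ} e = proj₁ (encode-injective φ ψ (toℕ-injective e))

Least : (ℕ → Set) → Set
Least P = Σ ℕ λ n → P n × (∀ k → k < n → ¬ P k)

least-unique : ∀ {P Q : ℕ → Set} → (∀ k → P k → Q k) → (∀ k → Q k → P k) →
               (p : Least P) (q : Least Q) → proj₁ p ≡ proj₁ q
least-unique P⇒Q Q⇒P (m , pm , below-m) (n , qn , below-n) with <-cmp m n
... | tri< m<n _ _ = ⊥-elim (below-n m m<n (P⇒Q m pm))
... | tri≈ _ m≡n _ = m≡n
... | tri> _ _ n<m = ⊥-elim (below-m n n<m (Q⇒P n qn))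

module _ (em : ExcludedMiddle 0ℓ) where

  least : (P : ℕ → Set) → ∀ n → P n → Least P
  least P = <-rec (λ n → P n → Least P) step
    where
    step : ∀ n → (∀ {k} → k < n → P k → Least P) → P n → Least P
    step n rec pn with em {∃ λ k → k < n × P k}
    ... | yes (k , k<n , pk) = rec k<n pk
    ... | no none            = n , pn , λ k k<n pk → none (k , k<n , pk)

  module Lindenbaum (B : FmSet) (B-consistent : Consistent B) where

    Candidate : FmSet → ℕ → Set
    Candidate S n = Σ Fm λ φ → code φ ≡ n × Consistent (S ⊕ φ)

    extend : ∀ S n → Dec (Candidate S n) → FmSet
    extend S _ (yes (φ , _)) = S ⊕ φ
    extend S _ (no _)        = S

    ⊆-extend : ∀ S n (c : Dec (Candidate S n)) → S ⊆ extend S n c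
    ⊆-extend S _ (yes _) _ = inj₁
    ⊆-extend S _ (no _)  _ = λ φ∈ → φ∈

    extend-consistent : ∀ S n (c : Dec (Candidate S n)) → Consistent S → Consistent (extend S n c)
    extend-consistent S _ (yes (_ , _ , cons)) _    = cons
    extend-consistent S _ (no _)               cons = cons

    -- Stage n + 1 decides the formula with code n, if there is one.
    stage : ℕ → FmSet
    stage zero    = B
    stage (suc n) = extend (stage n) n em

    stage-mono : ∀ {m n} → m ≤′ n → stage m ⊆ stage n
    stage-mono (≤′-reflexive refl)  _ φ∈ = φ∈
    stage-mono (≤′-step {n} m≤′n)   φ φ∈ = ⊆-extend (stage n) n em φ (stage-mono m≤′n φ φ∈)

    stage-consistent : ∀ n → Consistent (stage n)
    stage-consistent zero    = B-consistent
    stage-consistent (suc n) = extend-consistent (stage n) n em (stage-consistent n)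

    Limit : FmSet
    Limit φ = ∃ λ n → stage n φ

    finite-⊆-stage : ∀ l → All Limit l → ∃ λ n → All (stage n) l
    finite-⊆-stage []      []                = 0 , []
    finite-⊆-stage (φ ∷ l) ((m , φ∈) ∷ l⊆) with finite-⊆-stage l l⊆
    ... | n , l⊆n = m ⊔ n , stage-mono (≤⇒≤′ (m≤m⊔n m n)) φ φ∈
                          ∷ All.map (λ {ψ} → stage-mono (≤⇒≤′ (m≤n⊔m m n)) ψ) l⊆n

    Limit-consistent : Consistent Limit
    Limit-consistent (l , l⊆ , ⊢¬l) with finite-⊆-stage l l⊆
    ... | n , l⊆n = stage-consistent n (l , l⊆n , ⊢¬l)

    extend-decides : ∀ {Δ} S φ (c : Dec (Candidate S (code φ))) →
                     Consistent Δ → S ⊆ Δ → Δ φ → extend S (code φ) c φ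
    extend-decides S φ (no none) Δ-cons S⊆Δ φ∈Δ =
      ⊥-elim (none (φ , refl , λ (l , l⊆ , ⊢¬l) → Δ-cons (l , All.map [ S⊆Δ _ , (λ { refl → φ∈Δ }) ] l⊆ , ⊢¬l)))
    extend-decides S φ (yes (ψ , eq , _)) _ _ _ with code-injective {ψ} {φ} eq
    ... | refl = inj₂ refl

    Limit-maximal : (Δ : FmSet) → Limit ⊆ Δ → Consistent Δ → Δ ⊆ Limit
    Limit-maximal Δ Limit⊆Δ Δ-cons φ φ∈Δ =
      suc (code φ) , extend-decides (stage (code φ)) φ em Δ-cons (λ ψ ψ∈ → Limit⊆Δ ψ (code φ , ψ∈)) φ∈Δ

  lindenbaum : (B : FmSet) → Consistent B → Σ FmSet λ Δ → MaxCons Δ × B ⊆ Δ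
  lindenbaum B B-consistent = Limit , (Limit-consistent , Limit-maximal) , λ _ φ∈ → 0 , φ∈
    where open Lindenbaum B B-consistent

  module CanonicalValuation {Δ : FmSet} (mc : MaxCons Δ) where
    open MCS mc

    Defined : Agent → Fm → Const → Set
    Defined j φ d = Δ (∇ j φ d ∧' ◇ j φ)

    ClassCode : Agent → Fm → Const → ℕ → Set
    ClassCode j φ d n = Σ Fm λ χ → code χ ≡ n × Defined j χ d × Δ (∇ j (φ ∨' χ) d)

    ClassCode-transfer : ∀ {j φ ψ d} → Δ (◇ j φ) → Δ (∇ j (φ ∨' ψ) d) →
                         ∀ n → ClassCode j φ d n → ClassCode j ψ d n
    ClassCode-transfer ◇φ∈ φψ∈ n (χ , eq , χ-def , φχ∈) = χ , eq , χ-def , ∇∨-trans ◇φ∈ (∇∨-sym φψ∈) φχ∈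

    least-ClassCode : ∀ {j φ d} → Defined j φ d → Least (ClassCode j φ d)
    least-ClassCode {j} {φ} {d} φ-def = least (ClassCode j φ d) (code φ) (φ , refl , φ-def , ∇∨-refl (∧-∈ˡ φ-def))

    same-least-ClassCode : ∀ {j φ ψ d} (p : Least (ClassCode j φ d)) (q : Least (ClassCode j ψ d)) →
                           proj₁ p ≡ proj₁ q → Δ (∇ j (φ ∨' ψ) d)
    same-least-ClassCode (m , (χ , eχ , χ-def , φχ∈) , _) (n , (χ′ , eχ′ , _ , ψχ′∈) , _) m≡n
      with code-injective {χ} {χ′} (trans eχ (trans m≡n (sym eχ′)))
    ... | refl = ∇∨-trans (∧-∈ʳ χ-def) φχ∈ (∇∨-sym ψχ′∈)

    value : ∀ {j φ d} → Dec (Defined j φ d) → Maybe ℕ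
    value (yes φ-def) = just (proj₁ (least-ClassCode φ-def))
    value (no _)      = nothing

    value-defined : ∀ {j φ d} (x : Dec (Defined j φ d)) →
                    (value x ≢ nothing → Defined j φ d) × (Defined j φ d → value x ≢ nothing)
    value-defined (yes φ-def) = const φ-def , λ _ ()
    value-defined (no ¬def)   = (λ v≢ → ⊥-elim (v≢ refl)) , λ φ-def → ⊥-elim (¬def φ-def)

    value-equal : ∀ {j φ ψ d} (x : Dec (Defined j φ d)) (y : Dec (Defined j ψ d)) {m n} →
                  value x ≡ just m → value y ≡ just n →
                  (m ≡ n → Δ (∇ j (φ ∨' ψ) d)) × (Δ (∇ j (φ ∨' ψ) d) → m ≡ n)
    value-equal (yes φ-def) (yes ψ-def) refl refl =
      same-least-ClassCode (least-ClassCode φ-def) (least-ClassCode ψ-def) ,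
      λ φψ∈ → least-unique (ClassCode-transfer (∧-∈ʳ φ-def) φψ∈)
                           (ClassCode-transfer (∧-∈ʳ ψ-def) (∇∨-sym φψ∈))
                           (least-ClassCode φ-def) (least-ClassCode ψ-def)
    value-equal (no _)  _      ()   _
    value-equal (yes _) (no _) _    ()

  canonicalState : (Δ : FmSet) → MaxCons Δ → (Const → ℕ) → State
  canonicalState Δ mc f = record
    { Γ = Δ ; mcs = mc ; f = f ; g = λ j φ d → value em
    ; c1 = λ j φ d → value-defined em
    ; c2 = λ j φ ψ d m n → value-equal em em }
    where open CanonicalValuation mc

Boxed : Agent → FmSet → FmSet
Boxed i Γ φ = Γ (□ i φ)

Boxed-¬-consistent : ∀ {Γ i φ} → MaxCons Γ → Γ (¬' □ i φ) → Consistent (Boxed i Γ ⊕ ¬' φ)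
Boxed-¬-consistent {φ = φ} mc ¬□φ∈ = ⊕-consistent λ m m⊆ ⊢m⇒¬¬φ →
  ¬-∈⇒∉ ¬□φ∈ (□-mono-∈ (mp-⊨ ⊢m⇒¬¬φ (⇒¬¬⊨⇒ {conj m} {φ})) (□-conj-∈ m⊆))
  where open MCS mc

◇-∈-of-successor : ∀ {Γ Δ i φ} → MaxCons Γ → MaxCons Δ → Boxed i Γ ⊆ Δ → Δ φ → Γ (◇ i φ)
◇-∈-of-successor {φ = φ} mcΓ mcΔ Boxed⊆Δ φ∈Δ = Γ.∈-stable λ ◇φ∉ →
  Δ.¬-∈⇒∉ (Boxed⊆Δ (¬' φ) (Γ.∈-stable λ □¬φ∉ → ◇φ∉ (Γ.∉⇒¬-∈ □¬φ∉))) φ∈Δ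
  where
  module Γ = MCS mcΓ
  module Δ = MCS mcΔ

is-just : (x : Maybe ℕ) → x ≢ nothing → ∃ λ n → x ≡ just n
is-just (just n) _   = n , refl
is-just nothing  x≢ = ⊥-elim (x≢ refl)

module Successor (s : State) (i : Agent) {Δ : FmSet} (mcΔ : MaxCons Δ) (Boxed⊆Δ : Boxed i (Γ s) ⊆ Δ) where
  private
    module Γs = MCS (mcs s)
    module Δ = MCS mcΔ

  Witness : Const → Set
  Witness d = Σ Fm λ φ → Γ s (∇ i φ d) × Δ φ

  witness-value : ∀ {d} → ((φ , _) : Witness d) → ∃ λ n → g s i φ d ≡ just n
  witness-value {d} (φ , ∇φ∈ , φ∈Δ) =
    is-just (g s i φ d) (proj₂ (c1 s i φ d) (Γs.∧-∈ ∇φ∈ (◇-∈-of-successor (mcs s) mcΔ Boxed⊆Δ φ∈Δ)))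

  witness-value-unique : ∀ {d} (w w′ : Witness d) → g s i (proj₁ w) d ≡ g s i (proj₁ w′) d
  witness-value-unique {d} w@(φ , ∇φ∈ , φ∈Δ) w′@(ψ , ∇ψ∈ , ψ∈Δ)
    with witness-value w | witness-value w′
  ... | m , gφ≡m | n , gψ≡n = trans gφ≡m (trans (cong just m≡n) (sym gψ≡n))
    where
    m≡n : m ≡ n
    m≡n = proj₂ (c2 s i φ ψ d m n gφ≡m gψ≡n)
      (Γs.∇-join-∈ (◇-∈-of-successor (mcs s) mcΔ Boxed⊆Δ (Δ.∧-∈ φ∈Δ ψ∈Δ)) ∇φ∈ ∇ψ∈)

  valueFrom : ∀ {d} → Dec (Witness d) → ℕ
  valueFrom (yes w) = proj₁ (witness-value w)
  valueFrom (no _)  = 0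

  valueFrom-correct : ∀ {φ d} (x : Dec (Witness d)) → Γ s (∇ i φ d) → Δ φ → g s i φ d ≡ just (valueFrom x)
  valueFrom-correct (yes w) ∇φ∈ φ∈Δ = trans (witness-value-unique (_ , ∇φ∈ , φ∈Δ) w) (proj₂ (witness-value w))
  valueFrom-correct (no ¬w) ∇φ∈ φ∈Δ = ⊥-elim (¬w (_ , ∇φ∈ , φ∈Δ))

lemma1 : ExcludedMiddle 0ℓ → (s : State) (i : Agent) (φ : Fm) →
    Γ s (¬' □ i φ) → Σ State λ t → Rc i s t × Γ t (¬' φ)
lemma1 em s i φ ¬□φ∈ with lindenbaum em (Boxed i (Γ s) ⊕ ¬' φ) (Boxed-¬-consistent (mcs s) ¬□φ∈)
... | Δ , mcΔ , Base⊆Δ = t , (Boxed⊆Δ , λ ψ d → valueFrom-correct em) , Base⊆Δ (¬' φ) (inj₂ refl)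
  where
  Boxed⊆Δ : Boxed i (Γ s) ⊆ Δ
  Boxed⊆Δ ψ □ψ∈ = Base⊆Δ ψ (inj₁ □ψ∈)

  open Successor s i mcΔ Boxed⊆Δ

  t : State
  t = canonicalState em Δ mcΔ λ d → valueFrom em
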